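{- Let $\mathbb{F}$ be a field of characteristic zero and let $\psi$ be the $\mathbb{F}$-linear functional on $\mathbb{F}[\alpha_1,\alpha_2]$ defined on monomials by $\psi(\alpha_1^{2m}\alpha_2^{2n})=\Omega(m,n)1_{\mathbb{F}}$ for $m,n\in\mathbb{N}$ and $\psi(\alpha_1^k\alpha_2^l)=0$ if $k$ or $l$ is odd. Then $\psi(h\cdot\pi)=\psi(\pi)$ for all $\pi\in\mathbb{F}[\alpha_1,\alpha_2]$ and all $h\in SO(2,\mathbb{F})$.
   Context: $\mathbb{N}$ includes $0$. $\Omega(m,n)=\dfrac{(2m)!(2n)!}{4^{m+n}\,m!\,n!\,(m+n)!}$, and $a1_{\mathbb{F}}$ is the image of $a\in\mathbb{Q}$ in $\mathbb{F}$. $SO(2,\mathbb{F})$ is the group of $2\times2$ matrices $h$ over $\mathbb{F}$ with $h^{ -1}=h^T$ and $\det h=1$; it acts on $\mathbb{F}[\alpha_1,\alpha_2]$ by $h\cdot\pi(\alpha_1,\alpha_2)=\pi(h_{11}\alpha_1+h_{21}\alpha_2,\,h_{12}\alpha_1+h_{22}\alpha_2)$. -}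

module Defs where

open import Level using (Level; _⊔_)
open import Algebra.Bundles using (CommutativeRing)
open import Data.Nat as ℕ using (ℕ; zero; suc; _!; NonZero)
open import Data.Nat.Properties using (m*n≢0; m^n≢0; _!≢0)
open import Data.Integer as ℤ using (ℤ; +_; -[1+_])
open import Data.Rational as ℚ using (ℚ; ↥_; ↧ₙ_)
open import Data.Product using (Σ; proj₁; _×_; _,_)
open import Data.List using (List; []; _∷_; _++_; map; concatMap; foldr)
open import Data.Maybe using (Maybe; just; nothing)
open import Relation.Nullary using (¬_)

record Field (c ℓ : Level) : Set (Level.suc (c ⊔ ℓ)) where
  field
    commRing : CommutativeRing c ℓ
  open CommutativeRing commRing public
  field
    0≉1 : ¬ (0# ≈ 1#)
    inverse : ∀ x → ¬ (x ≈ 0#) → Σ Carrier (λ y → x * y ≈ 1#)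

module _ {c ℓ} (F : Field c ℓ) where
  open Field F

  ℕ1 : ℕ → Carrier
  ℕ1 zero = 0#
  ℕ1 (suc n) = 1# + ℕ1 n

  CharZero : Set ℓ
  CharZero = ∀ n → ¬ (ℕ1 (suc n) ≈ 0#)

  ℤ1 : ℤ → Carrier
  ℤ1 (+ n) = ℕ1 n
  ℤ1 -[1+ n ] = - ℕ1 (suc n)

  ℚ1 : CharZero → ℚ → Carrier
  ℚ1 ch q = ℤ1 (↥ q) * proj₁ (inverse (ℕ1 (↧ₙ q)) (ch (ℚ.ℚ.denominator-1 q)))

Ωden : ℕ → ℕ → ℕ
Ωden m n = 4 ℕ.^ (m ℕ.+ n) ℕ.* (m ! ℕ.* (n ! ℕ.* (m ℕ.+ n) !))

Ωden≢0 : ∀ m n → NonZero (Ωden m n)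
Ωden≢0 m n = m*n≢0 _ _ {{m^n≢0 4 (m ℕ.+ n)}}
               {{m*n≢0 _ _ {{m !≢0}} {{m*n≢0 _ _ {{n !≢0}} {{(m ℕ.+ n) !≢0}}}}}}

Ω : ℕ → ℕ → ℚ
Ω m n = (+ ((2 ℕ.* m) ! ℕ.* (2 ℕ.* n) !) ℚ./ Ωden m n) {{Ωden≢0 m n}}

half : ℕ → Maybe ℕ
half zero = just zero
half (suc zero) = nothing
half (suc (suc k)) = Data.Maybe.map suc (half k)

-- Polynomials in F[α₁,α₂], represented as finite formal sums of terms
-- c · α₁^k α₂^l, a term being (c , k , l).

module Poly {c ℓ} (F : Field c ℓ) where
  open Field F

  Term : Set c
  Term = Carrier × ℕ × ℕ

  Pol : Set c
  Pol = List Term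

  one : Pol
  one = (1# , 0 , 0) ∷ []

  _⊕_ : Pol → Pol → Pol
  _⊕_ = _++_

  scale : Carrier → Pol → Pol
  scale a = map (λ { (b , k , l) → (a * b , k , l) })

  _⊗_ : Pol → Pol → Pol
  p ⊗ q = concatMap (λ { (a , k , l) →
            map (λ { (b , k' , l') → (a * b , k ℕ.+ k' , l ℕ.+ l') }) q }) p

  _^^_ : Pol → ℕ → Pol
  p ^^ zero = one
  p ^^ suc n = p ⊗ (p ^^ n)

  lin : Carrier → Carrier → Pol
  lin a b = (a , 1 , 0) ∷ (b , 0 , 1) ∷ []

  subst : Carrier → Carrier → Carrier → Carrier → Pol → Pol
  subst a₁ a₂ b₁ b₂ = concatMap (λ { (c₀ , k , l) →
                        scale c₀ ((lin a₁ a₂ ^^ k) ⊗ (lin b₁ b₂ ^^ l)) })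

  record Mat2 : Set c where
    constructor mat
    field h₁₁ h₁₂ h₂₁ h₂₂ : Carrier
  open Mat2 public

  record InSO2 (h : Mat2) : Set ℓ where
    field
      hhᵀ₁₁ : h₁₁ h * h₁₁ h + h₁₂ h * h₁₂ h ≈ 1#
      hhᵀ₁₂ : h₁₁ h * h₂₁ h + h₁₂ h * h₂₂ h ≈ 0#
      hhᵀ₂₁ : h₂₁ h * h₁₁ h + h₂₂ h * h₁₂ h ≈ 0#
      hhᵀ₂₂ : h₂₁ h * h₂₁ h + h₂₂ h * h₂₂ h ≈ 1#
      hᵀh₁₁ : h₁₁ h * h₁₁ h + h₂₁ h * h₂₁ h ≈ 1#
      hᵀh₁₂ : h₁₁ h * h₁₂ h + h₂₁ h * h₂₂ h ≈ 0#
      hᵀh₂₁ : h₁₂ h * h₁₁ h + h₂₂ h * h₂₁ h ≈ 0#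
      hᵀh₂₂ : h₁₂ h * h₁₂ h + h₂₂ h * h₂₂ h ≈ 1#
      det   : h₁₁ h * h₂₂ h - h₁₂ h * h₂₁ h ≈ 1#

  act : Mat2 → Pol → Pol
  act h = subst (h₁₁ h) (h₂₁ h) (h₁₂ h) (h₂₂ h)

  module _ (ch : CharZero F) where

    ψmon : ℕ → ℕ → Carrier
    ψmon k l with half k | half l
    ... | just m  | just n  = ℚ1 F ch (Ω m n)
    ... | just _  | nothing = 0#
    ... | nothing | _       = 0#

    ψ : Pol → Carrier
    ψ = foldr (λ { (a , k , l) r → a * ψmon k l + r }) 0#

{-# OPTIONS --safe #-}
-- Ω(m,n) is the mean of cos²ᵐθ sin²ⁿθ over the circle, and ψ satisfies the integration-by-parts
-- recursion (x+y+1) ψ(α₁ˣ⁺¹α₂ʸ) = x ψ(α₁ˣ⁻¹α₂ʸ) together with its mirror image in α₂ (ψ is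
-- symmetric in α₁, α₂). For a product of linear forms ℓ₀ℓ₁⋯ℓ_N the two recursions combine to
-- (N+1) ψ(ℓ₀ℓ₁⋯ℓ_N) = Σᵢ ⟪ℓ₀,ℓᵢ⟫ ψ(∏_{j≠0,i} ℓⱼ), so ψ of such a product depends only on the Gram
-- matrix of the forms. The action of h turns α₁ᵏα₂ˡ into the product of k copies of the form given
-- by the first column of h and l copies of the one given by the second column; hᵀh = I says that
-- these have the same Gram matrix as α₁ and α₂.

module Submission where

open import Defs
open import Data.Bool using (Bool; true; false)
open import Data.Integer as ℤ using (+_; -[1+_])
import Data.Integer.Properties as ℤP
open import Data.List using (List; []; _∷_; _++_; map; length; replicate)
import Data.List.Properties as ListP
open import Data.Maybe as Maybe using (just; nothing)
open import Data.Nat as ℕ using (ℕ; zero; suc; pred; _!; NonZero)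
import Data.Nat.GCD as GCD
import Data.Nat.Properties as ℕP
open import Data.Nat.Tactic.RingSolver using (solve-∀)
open import Data.Product using (_×_; proj₁; proj₂; _,_; swap)
import Data.Rational as ℚ
import Data.Rational.Properties as ℚP
open import Function using (flip)
open import Relation.Nullary using (¬_)
import Relation.Binary.PropositionalEquality as ≡
open ≡ using (_≡_)

double : ℕ → ℕ
double zero = zero
double (suc m) = suc (suc (double m))

double≡2* : ∀ m → double m ≡ 2 ℕ.* m
double≡2* zero = ≡.refl
double≡2* (suc m) = ≡.trans (≡.cong (λ k → suc (suc k)) (double≡2* m)) (≡.sym (ℕP.*-suc 2 m))

half-double : ∀ m → half (double m) ≡ just m
half-double zero = ≡.refl
half-double (suc m) = ≡.cong (Maybe.map suc) (half-double m)

half-suc-double : ∀ m → half (suc (double m)) ≡ nothing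
half-suc-double zero = ≡.refl
half-suc-double (suc m) = ≡.cong (Maybe.map suc) (half-suc-double m)

data Parity : ℕ → Set where
  even : ∀ m → Parity (double m)
  odd  : ∀ m → Parity (suc (double m))

parity : ∀ k → Parity k
parity zero = even zero
parity (suc k) with parity k
... | even m = odd m
... | odd m = even (suc m)

Ωnum : ℕ → ℕ → ℕ
Ωnum m n = (2 ℕ.* m) ! ℕ.* (2 ℕ.* n) !

Ωden-comm : ∀ m n → Ωden m n ≡ Ωden n m
Ωden-comm m n rewrite ℕP.+-comm m n = ≡.cong (4 ℕ.^ (n ℕ.+ m) ℕ.*_) (lemma (m !) (n !) ((n ℕ.+ m) !))
  where
  lemma : ∀ a b c → a ℕ.* (b ℕ.* c) ≡ b ℕ.* (a ℕ.* c)
  lemma = solve-∀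

Ω-comm : ∀ m n → Ω m n ≡ Ω n m
Ω-comm m n = /-cong {{Ωden≢0 m n}} {{Ωden≢0 n m}} (ℕP.*-comm ((2 ℕ.* m) !) ((2 ℕ.* n) !)) (Ωden-comm m n)
  where
  /-cong : ∀ {p p′ d d′} .{{_ : NonZero d}} .{{_ : NonZero d′}} →
           p ≡ p′ → d ≡ d′ → + p ℚ./ d ≡ + p′ ℚ./ d′
  /-cong ≡.refl ≡.refl = ≡.refl

Ωnum-double : ∀ m n → Ωnum m n ≡ double m ! ℕ.* double n !
Ωnum-double m n = ≡.sym (≡.cong₂ (λ a b → a ! ℕ.* b !) (double≡2* m) (double≡2* n))

-- (2m + 2n + 2) Ω(m+1,n) = (2m+1) Ω(m,n), cleared of denominators
Ω-suc-cross : ∀ m n →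
  suc (suc (double m) ℕ.+ double n) ℕ.* Ωnum (suc m) n ℕ.* Ωden m n
    ≡ suc (double m) ℕ.* Ωnum m n ℕ.* Ωden (suc m) n
Ω-suc-cross m n rewrite Ωnum-double (suc m) n | Ωnum-double m n | double≡2* m | double≡2* n =
  identity m n ((2 ℕ.* m) !) ((2 ℕ.* n) !) (m !) (n !) ((m ℕ.+ n) !) (4 ℕ.^ (m ℕ.+ n))
  where
  identity : ∀ m n a b c d e f →
    (2 ℕ.+ 2 ℕ.* m ℕ.+ 2 ℕ.* n) ℕ.* ((2 ℕ.+ 2 ℕ.* m) ℕ.* ((1 ℕ.+ 2 ℕ.* m) ℕ.* a) ℕ.* b) ℕ.* (f ℕ.* (c ℕ.* (d ℕ.* e)))
      ≡ (1 ℕ.+ 2 ℕ.* m) ℕ.* (a ℕ.* b) ℕ.* (4 ℕ.* f ℕ.* ((1 ℕ.+ m) ℕ.* c ℕ.* (d ℕ.* ((1 ℕ.+ (m ℕ.+ n)) ℕ.* e))))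
  identity = solve-∀

module _ {c ℓ} (F : Field c ℓ) where
  open Field F
  open import Algebra.Properties.Semiring.Mult semiring as Mult using (×1-homo-*)
  open import Algebra.Properties.Ring ring using (-‿distribˡ-*)
  open import Algebra.Solver.Ring.NaturalCoefficients.Default commutativeSemiring
  open import Relation.Binary.Reasoning.Setoid setoid

  ℕ1≡×1# : ∀ n → ℕ1 F n ≡ n Mult.× 1#
  ℕ1≡×1# zero = ≡.refl
  ℕ1≡×1# (suc n) = ≡.cong (λ x → 1# + x) (ℕ1≡×1# n)

  ℕ1-homo-* : ∀ m n → ℕ1 F (m ℕ.* n) ≈ ℕ1 F m * ℕ1 F n
  ℕ1-homo-* m n rewrite ℕ1≡×1# (m ℕ.* n) | ℕ1≡×1# m | ℕ1≡×1# n = ×1-homo-* m n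

  ℤ1-homo-*-+ : ∀ z n → ℤ1 F (z ℤ.* + n) ≈ ℤ1 F z * ℕ1 F n
  ℤ1-homo-*-+ (+ m) n = trans (reflexive (≡.cong (ℤ1 F) (≡.sym (ℤP.pos-* m n)))) (ℕ1-homo-* m n)
  ℤ1-homo-*-+ -[1+ m ] zero = begin
    ℤ1 F (-[1+ m ] ℤ.* + 0) ≈⟨ reflexive (≡.cong (ℤ1 F) (ℤP.*-zeroʳ -[1+ m ])) ⟩
    0#                     ≈⟨ sym (zeroʳ _) ⟩
    ℤ1 F -[1+ m ] * 0#     ∎
  ℤ1-homo-*-+ -[1+ m ] (suc n) = begin
    - ℕ1 F (suc m ℕ.* suc n)  ≈⟨ -‿cong (ℕ1-homo-* (suc m) (suc n)) ⟩
    - (ℕ1 F (suc m) * ℕ1 F (suc n)) ≈⟨ -‿distribˡ-* _ _ ⟩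
    - ℕ1 F (suc m) * ℕ1 F (suc n) ∎

  *-cancelˡ-≉0 : ∀ {z u v} → ¬ (z ≈ 0#) → z * u ≈ z * v → u ≈ v
  *-cancelˡ-≉0 {z} {u} {v} z≉0 zu≈zv = begin
    u             ≈⟨ *-identityˡ u ⟨
    1# * u        ≈⟨ *-congʳ yz≈1 ⟨
    (y * z) * u   ≈⟨ *-assoc y z u ⟩
    y * (z * u)   ≈⟨ *-congˡ zu≈zv ⟩
    y * (z * v)   ≈⟨ *-assoc y z v ⟨
    (y * z) * v   ≈⟨ *-congʳ yz≈1 ⟩
    1# * v        ≈⟨ *-identityˡ v ⟩
    v             ∎
    where
    y = proj₁ (inverse z z≉0)
    yz≈1 = trans (*-comm y z) (proj₂ (inverse z z≉0))

  -- at x = 0 the right-hand side is 0, so the junk value G (pred 0) y is harmless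
  IntegratesByParts : (ℕ → ℕ → Carrier) → Set ℓ
  IntegratesByParts G = ∀ x y → ℕ1 F (suc (x ℕ.+ y)) * G (suc x) y ≈ ℕ1 F x * G (pred x) y

  module _ (ch : CharZero F) where

    ℕ1-≉0 : ∀ n .{{_ : NonZero n}} → ¬ (ℕ1 F n ≈ 0#)
    ℕ1-≉0 (suc n) = ch n

    ℚ1-/-*-denominator : ∀ p d .{{_ : NonZero d}} → ℚ1 F ch (+ p ℚ./ d) * ℕ1 F d ≈ ℕ1 F p
    ℚ1-/-*-denominator p d = begin
      ℚ1 F ch q * ℕ1 F d                         ≈⟨ *-congˡ (reflexive (≡.cong (ℤ1 F) (ℚP.↧-/ (+ p) d))) ⟨
      (ℤ1 F (ℚ.↥ q) * y) * ℤ1 F (ℚ.↧ q ℤ.* + g)    ≈⟨ *-congˡ (ℤ1-homo-*-+ (ℚ.↧ q) g) ⟩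
      (ℤ1 F (ℚ.↥ q) * y) * (ℕ1 F (ℚ.↧ₙ q) * ℕ1 F g)
        ≈⟨ solve 4 (λ a y b c → (a :* y) :* (b :* c) := a :* ((b :* y) :* c)) refl _ y _ _ ⟩
      ℤ1 F (ℚ.↥ q) * ((ℕ1 F (ℚ.↧ₙ q) * y) * ℕ1 F g) ≈⟨ *-congˡ (trans (*-congʳ y-inverse) (*-identityˡ _)) ⟩
      ℤ1 F (ℚ.↥ q) * ℕ1 F g                        ≈⟨ ℤ1-homo-*-+ (ℚ.↥ q) g ⟨
      ℤ1 F (ℚ.↥ q ℤ.* + g)                         ≈⟨ reflexive (≡.cong (ℤ1 F) (ℚP.↥-/ (+ p) d)) ⟩
      ℕ1 F p                                       ∎
      where
      q = + p ℚ./ d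
      g = GCD.gcd p d
      y = proj₁ (inverse (ℕ1 F (ℚ.↧ₙ q)) (ch (ℚ.ℚ.denominator-1 q)))
      y-inverse = proj₂ (inverse (ℕ1 F (ℚ.↧ₙ q)) (ch (ℚ.ℚ.denominator-1 q)))

    ℚ1-cross : ∀ a b p d p′ d′ .{{_ : NonZero d}} .{{_ : NonZero d′}} →
               a ℕ.* p ℕ.* d′ ≡ b ℕ.* p′ ℕ.* d →
               ℕ1 F a * ℚ1 F ch (+ p ℚ./ d) ≈ ℕ1 F b * ℚ1 F ch (+ p′ ℚ./ d′)
    ℚ1-cross a b p d p′ d′ cross = *-cancelˡ-≉0 dd′≉0 (begin
      (D * D′) * (A * q)    ≈⟨ solve 4 (λ a q d d′ → (d :* d′) :* (a :* q) := a :* (q :* d) :* d′) refl A q D D′ ⟩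
      A * (q * D) * D′      ≈⟨ *-congʳ (*-congˡ (ℚ1-/-*-denominator p d)) ⟩
      A * ℕ1 F p * D′       ≈⟨ ℕ1-homo-*₃ a p d′ ⟨
      ℕ1 F (a ℕ.* p ℕ.* d′)  ≡⟨ ≡.cong (ℕ1 F) cross ⟩
      ℕ1 F (b ℕ.* p′ ℕ.* d)  ≈⟨ ℕ1-homo-*₃ b p′ d ⟩
      B * ℕ1 F p′ * D       ≈⟨ *-congʳ (*-congˡ (ℚ1-/-*-denominator p′ d′)) ⟨
      B * (q′ * D′) * D     ≈⟨ solve 4 (λ b q′ d′ d → b :* (q′ :* d′) :* d := (d :* d′) :* (b :* q′)) refl B q′ D′ D ⟩
      (D * D′) * (B * q′)   ∎)
      where
      A = ℕ1 F a
      B = ℕ1 F b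
      D = ℕ1 F d
      D′ = ℕ1 F d′
      q = ℚ1 F ch (+ p ℚ./ d)
      q′ = ℚ1 F ch (+ p′ ℚ./ d′)
      ℕ1-homo-*₃ : ∀ x y z → ℕ1 F (x ℕ.* y ℕ.* z) ≈ ℕ1 F x * ℕ1 F y * ℕ1 F z
      ℕ1-homo-*₃ x y z = trans (ℕ1-homo-* (x ℕ.* y) z) (*-congʳ (ℕ1-homo-* x y))
      dd′≉0 : ¬ (D * D′ ≈ 0#)
      dd′≉0 e = ℕ1-≉0 (d ℕ.* d′) {{ℕP.m*n≢0 d d′}} (trans (ℕ1-homo-* d d′) e)

    ℚ1-Ω-suc : ∀ m n → ℕ1 F (suc (suc (double m) ℕ.+ double n)) * ℚ1 F ch (Ω (suc m) n)
                       ≈ ℕ1 F (suc (double m)) * ℚ1 F ch (Ω m n)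
    ℚ1-Ω-suc m n = ℚ1-cross (suc (suc (double m) ℕ.+ double n)) (suc (double m))
                     (Ωnum (suc m) n) (Ωden (suc m) n) (Ωnum m n) (Ωden m n)
                     {{Ωden≢0 (suc m) n}} {{Ωden≢0 m n}} (Ω-suc-cross m n)

    open Poly F using (ψmon)

    ψmon-even : ∀ m n → ψmon ch (double m) (double n) ≈ ℚ1 F ch (Ω m n)
    ψmon-even m n rewrite half-double m | half-double n = refl

    ψmon-odd₁ : ∀ m l → ψmon ch (suc (double m)) l ≈ 0#
    ψmon-odd₁ m l rewrite half-suc-double m = refl

    ψmon-odd₂ : ∀ k n → ψmon ch k (suc (double n)) ≈ 0#
    ψmon-odd₂ k n with half k
    ... | nothing = refl
    ... | just _ rewrite half-suc-double n = refl

    ψmon-comm : ∀ k l → ψmon ch k l ≈ ψmon ch l k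
    ψmon-comm k l with parity k | parity l
    ... | even m | even n = begin
      ψmon ch (double m) (double n) ≈⟨ ψmon-even m n ⟩
      ℚ1 F ch (Ω m n)               ≡⟨ ≡.cong (ℚ1 F ch) (Ω-comm m n) ⟩
      ℚ1 F ch (Ω n m)               ≈⟨ ψmon-even n m ⟨
      ψmon ch (double n) (double m) ∎
    ... | odd m  | _      = trans (ψmon-odd₁ m l) (sym (ψmon-odd₂ l m))
    ... | even m | odd n  = trans (ψmon-odd₂ k n) (sym (ψmon-odd₁ n k))

    ψmon-integratesByParts : IntegratesByParts (ψmon ch)
    ψmon-integratesByParts x y with parity x | parity y
    ... | odd m  | even n = begin
      ℕ1 F (suc (suc (double m) ℕ.+ double n)) * ψmon ch (double (suc m)) (double n) ≈⟨ *-congˡ (ψmon-even (suc m) n) ⟩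
      ℕ1 F (suc (suc (double m) ℕ.+ double n)) * ℚ1 F ch (Ω (suc m) n)              ≈⟨ ℚ1-Ω-suc m n ⟩
      ℕ1 F (suc (double m)) * ℚ1 F ch (Ω m n)                                       ≈⟨ *-congˡ (ψmon-even m n) ⟨
      ℕ1 F (suc (double m)) * ψmon ch (double m) (double n)                         ∎
    ... | odd m  | odd n  = trans (*-congˡ (ψmon-odd₂ (suc x) n)) (trans (zeroʳ _) (sym (trans (*-congˡ (ψmon-odd₂ (double m) n)) (zeroʳ _))))
    ... | even m | _      = trans (*-congˡ (ψmon-odd₁ m y)) (trans (zeroʳ _) (sym (rhs≈0 m)))
      where
      rhs≈0 : ∀ m → ℕ1 F (double m) * ψmon ch (pred (double m)) y ≈ 0#
      rhs≈0 zero = zeroˡ _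
      rhs≈0 (suc m) = trans (*-congˡ (ψmon-odd₁ m y)) (zeroʳ _)

    ψmonᵀ-integratesByParts : IntegratesByParts (flip (ψmon ch))
    ψmonᵀ-integratesByParts x y = begin
      ℕ1 F (suc (x ℕ.+ y)) * ψmon ch y (suc x) ≈⟨ *-congˡ (ψmon-comm y (suc x)) ⟩
      ℕ1 F (suc (x ℕ.+ y)) * ψmon ch (suc x) y ≈⟨ ψmon-integratesByParts x y ⟩
      ℕ1 F x * ψmon ch (pred x) y              ≈⟨ *-congˡ (ψmon-comm (pred x) y) ⟩
      ℕ1 F x * ψmon ch y (pred x)              ∎

  LinearForm : Set c
  LinearForm = Carrier × Carrier

  ⟪_,_⟫ : LinearForm → LinearForm → Carrier
  ⟪ (a , b) , (a′ , b′) ⟫ = a * a′ + b * b′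

  -- moment G vs x y is G applied, by linearity, to α₁ˣ α₂ʸ times the product of the forms in vs
  moment : (ℕ → ℕ → Carrier) → List LinearForm → ℕ → ℕ → Carrier
  moment G [] x y = G x y
  moment G ((a , b) ∷ vs) x y = a * moment G vs (suc x) y + b * moment G vs x (suc y)

  -- the sum over i of f xᵢ (xs with xᵢ removed)
  sumPicks : ∀ {a} {A : Set a} → (A → List A → Carrier) → List A → Carrier
  sumPicks f [] = 0#
  sumPicks f (x ∷ xs) = f x xs + sumPicks (λ w r → f w (x ∷ r)) xs

  sumPicks-cong : ∀ {a} {A : Set a} {f g : A → List A → Carrier} (xs : List A) →
                  (∀ w r → f w r ≈ g w r) → sumPicks f xs ≈ sumPicks g xs
  sumPicks-cong [] f≈g = refl
  sumPicks-cong (x ∷ xs) f≈g = +-cong (f≈g x xs) (sumPicks-cong xs (λ w r → f≈g w (x ∷ r)))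

  sumPicks-+ : ∀ {a} {A : Set a} (f g : A → List A → Carrier) (xs : List A) →
               sumPicks (λ w r → f w r + g w r) xs ≈ sumPicks f xs + sumPicks g xs
  sumPicks-+ f g [] = sym (+-identityʳ 0#)
  sumPicks-+ f g (x ∷ xs) = trans (+-congˡ (sumPicks-+ _ _ xs))
    (solve 4 (λ p q u v → (p :+ q) :+ (u :+ v) := (p :+ u) :+ (q :+ v)) refl
      (f x xs) (g x xs) (sumPicks (λ w r → f w (x ∷ r)) xs) (sumPicks (λ w r → g w (x ∷ r)) xs))

  sumPicks-*ˡ : ∀ {a} {A : Set a} (k : Carrier) (f : A → List A → Carrier) (xs : List A) →
                sumPicks (λ w r → k * f w r) xs ≈ k * sumPicks f xs
  sumPicks-*ˡ k f [] = sym (zeroʳ k)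
  sumPicks-*ˡ k f (x ∷ xs) = trans (+-congˡ (sumPicks-*ˡ k _ xs)) (sym (distribˡ k _ _))

  sumPicks-map : ∀ {a b} {A : Set a} {B : Set b} (e : A → B) (f : B → List B → Carrier) (xs : List A) →
                 sumPicks f (map e xs) ≈ sumPicks (λ w r → f (e w) (map e r)) xs
  sumPicks-map e f [] = refl
  sumPicks-map e f (x ∷ xs) = +-congˡ (sumPicks-map e (λ w r → f w (e x ∷ r)) xs)

  sumPicks-cong-shorter : ∀ {a} {A : Set a} {f g : A → List A → Carrier} (xs : List A) →
                          (∀ w r → length r ℕ.< length xs → f w r ≈ g w r) → sumPicks f xs ≈ sumPicks g xs
  sumPicks-cong-shorter [] f≈g = refl
  sumPicks-cong-shorter (x ∷ xs) f≈g =
    +-cong (f≈g x xs (ℕP.n<1+n _)) (sumPicks-cong-shorter xs (λ w r r<xs → f≈g w (x ∷ r) (ℕ.s≤s r<xs)))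

  ℕ1-*-suc-pred : ∀ x (f : ℕ → Carrier) → ℕ1 F x * f (suc (pred x)) ≈ ℕ1 F x * f x
  ℕ1-*-suc-pred zero f = trans (zeroˡ _) (sym (zeroˡ _))
  ℕ1-*-suc-pred (suc x) f = refl

  module _ {G : ℕ → ℕ → Carrier} (G-parts : IntegratesByParts G) where

    moment-byParts : ∀ vs x y →
      ℕ1 F (suc (length vs ℕ.+ (x ℕ.+ y))) * moment G vs (suc x) y
        ≈ ℕ1 F x * moment G vs (pred x) y + sumPicks (λ w r → proj₁ w * moment G r x y) vs
    moment-byParts [] x y = trans (G-parts x y) (sym (+-identityʳ _))
    moment-byParts ((a , b) ∷ vs) x y = begin
      T * (a * M (suc (suc x)) y + b * M (suc x) (suc y))
        ≈⟨ solve 5 (λ t a b u v → t :* (a :* u :+ b :* v) := a :* (t :* u) :+ b :* (t :* v)) refl T a b _ _ ⟩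
      a * (T * M (suc (suc x)) y) + b * (T * M (suc x) (suc y))
        ≈⟨ +-cong (*-congˡ (trans (*-congʳ (reflexive (≡.cong (ℕ1 F) deg₁))) (moment-byParts vs (suc x) y)))
                  (*-congˡ (trans (*-congʳ (reflexive (≡.cong (ℕ1 F) deg₂))) (moment-byParts vs x (suc y)))) ⟩
      a * (ℕ1 F (suc x) * M x y + S₁) + b * (X * M (pred x) (suc y) + S₂)
        ≈⟨ +-congʳ (*-congˡ (+-congʳ (trans (distribʳ _ _ _) (+-congʳ (*-identityˡ _))))) ⟩
      a * ((M x y + X * M x y) + S₁) + b * (X * M (pred x) (suc y) + S₂)
        ≈⟨ solve 7 (λ a b X P Q S₁ S₂ → a :* ((P :+ X :* P) :+ S₁) :+ b :* (X :* Q :+ S₂) := a :* (X :* P) :+ b :* (X :* Q) :+ (a :* P :+ (a :* S₁ :+ b :* S₂))) refl a b X (M x y) (M (pred x) (suc y)) S₁ S₂ ⟩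
      a * (X * M x y) + b * (X * M (pred x) (suc y)) + (a * M x y + (a * S₁ + b * S₂))
        ≈⟨ +-cong (+-congʳ (*-congˡ (sym (ℕ1-*-suc-pred x (λ k → M k y))))) (+-congˡ (sym picks-∷)) ⟩
      a * (X * M (suc (pred x)) y) + b * (X * M (pred x) (suc y)) + (a * M x y + sumPicks (λ w r → proj₁ w * moment G ((a , b) ∷ r) x y) vs)
        ≈⟨ +-congʳ (solve 5 (λ a b X P Q → a :* (X :* P) :+ b :* (X :* Q) := X :* (a :* P :+ b :* Q)) refl a b X _ _) ⟩
      X * (a * M (suc (pred x)) y + b * M (pred x) (suc y)) + (a * M x y + sumPicks (λ w r → proj₁ w * moment G ((a , b) ∷ r) x y) vs) ∎
      where
      M = moment G vs
      X = ℕ1 F x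
      n = length vs
      T = ℕ1 F (suc (suc n ℕ.+ (x ℕ.+ y)))
      S₁ = sumPicks (λ w r → proj₁ w * moment G r (suc x) y) vs
      S₂ = sumPicks (λ w r → proj₁ w * moment G r x (suc y)) vs
      picks-∷ : sumPicks (λ w r → proj₁ w * moment G ((a , b) ∷ r) x y) vs ≈ a * S₁ + b * S₂
      picks-∷ = begin
        sumPicks (λ w r → proj₁ w * (a * moment G r (suc x) y + b * moment G r x (suc y))) vs
          ≈⟨ sumPicks-cong vs (λ w r → solve 5 (λ g a b u v → g :* (a :* u :+ b :* v) := a :* (g :* u) :+ b :* (g :* v)) refl (proj₁ w) a b _ _) ⟩
        sumPicks (λ w r → a * (proj₁ w * moment G r (suc x) y) + b * (proj₁ w * moment G r x (suc y))) vs
          ≈⟨ sumPicks-+ _ _ vs ⟩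
        sumPicks (λ w r → a * (proj₁ w * moment G r (suc x) y)) vs + sumPicks (λ w r → b * (proj₁ w * moment G r x (suc y))) vs
          ≈⟨ +-cong (sumPicks-*ˡ a _ vs) (sumPicks-*ˡ b _ vs) ⟩
        a * S₁ + b * S₂ ∎
      deg₁ : suc (suc n ℕ.+ (x ℕ.+ y)) ≡ suc (n ℕ.+ (suc x ℕ.+ y))
      deg₁ = ≡.cong suc (≡.sym (ℕP.+-suc n (x ℕ.+ y)))
      deg₂ : suc (suc n ℕ.+ (x ℕ.+ y)) ≡ suc (n ℕ.+ (x ℕ.+ suc y))
      deg₂ = ≡.cong suc (≡.sym (≡.trans (≡.cong (n ℕ.+_) (ℕP.+-suc x y)) (ℕP.+-suc n (x ℕ.+ y))))

  moment-transpose : ∀ G vs x y → moment G vs x y ≈ moment (flip G) (map swap vs) y x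
  moment-transpose G [] x y = refl
  moment-transpose G ((a , b) ∷ vs) x y =
    trans (+-comm _ _) (+-cong (*-congˡ (moment-transpose G vs x (suc y))) (*-congˡ (moment-transpose G vs (suc x) y)))

  module _ (ch : CharZero F) {G : ℕ → ℕ → Carrier}
           (G-parts : IntegratesByParts G) (Gᵀ-parts : IntegratesByParts (flip G)) where

    moment-byParts₂ : ∀ vs x y →
      ℕ1 F (suc (length vs ℕ.+ (x ℕ.+ y))) * moment G vs x (suc y)
        ≈ ℕ1 F y * moment G vs x (pred y) + sumPicks (λ w r → proj₂ w * moment G r x y) vs
    moment-byParts₂ vs x y = begin
      ℕ1 F (suc (length vs ℕ.+ (x ℕ.+ y))) * moment G vs x (suc y)
        ≈⟨ *-cong (reflexive (≡.cong (ℕ1 F) degree)) (moment-transpose G vs x (suc y)) ⟩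
      ℕ1 F (suc (length vsᵀ ℕ.+ (y ℕ.+ x))) * moment (flip G) vsᵀ (suc y) x
        ≈⟨ moment-byParts Gᵀ-parts vsᵀ y x ⟩
      ℕ1 F y * moment (flip G) vsᵀ (pred y) x + sumPicks (λ w r → proj₁ w * moment (flip G) r y x) vsᵀ
        ≈⟨ +-cong (*-congˡ (sym (moment-transpose G vs x (pred y)))) (sumPicks-map swap _ vs) ⟩
      ℕ1 F y * moment G vs x (pred y) + sumPicks (λ w r → proj₂ w * moment (flip G) (map swap r) y x) vs
        ≈⟨ +-congˡ (sumPicks-cong vs (λ w r → *-congˡ (sym (moment-transpose G r x y)))) ⟩
      ℕ1 F y * moment G vs x (pred y) + sumPicks (λ w r → proj₂ w * moment G r x y) vs ∎
      where
      vsᵀ = map swap vs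
      degree : suc (length vs ℕ.+ (x ℕ.+ y)) ≡ suc (length vsᵀ ℕ.+ (y ℕ.+ x))
      degree = ≡.cong₂ (λ n s → suc (n ℕ.+ s)) (≡.sym (ListP.length-map swap vs)) (ℕP.+-comm x y)

    moment-∷ : ∀ u vs → ℕ1 F (suc (length vs)) * moment G (u ∷ vs) 0 0
                          ≈ sumPicks (λ w r → ⟪ u , w ⟫ * moment G r 0 0) vs
    moment-∷ (a , b) vs = begin
      T * (a * moment G vs 1 0 + b * moment G vs 0 1)
        ≈⟨ solve 5 (λ t a b u v → t :* (a :* u :+ b :* v) := a :* (t :* u) :+ b :* (t :* v)) refl T a b _ _ ⟩
      a * (T * moment G vs 1 0) + b * (T * moment G vs 0 1)
        ≈⟨ +-cong (*-congˡ (trans (*-congʳ T≈) (moment-byParts G-parts vs 0 0)))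
                  (*-congˡ (trans (*-congʳ T≈) (moment-byParts₂ vs 0 0))) ⟩
      a * (0# * moment G vs 0 0 + S₁) + b * (0# * moment G vs 0 0 + S₂)
        ≈⟨ +-cong (*-congˡ (trans (+-congʳ (zeroˡ _)) (+-identityˡ S₁))) (*-congˡ (trans (+-congʳ (zeroˡ _)) (+-identityˡ S₂))) ⟩
      a * S₁ + b * S₂
        ≈⟨ +-cong (sumPicks-*ˡ a _ vs) (sumPicks-*ˡ b _ vs) ⟨
      sumPicks (λ w r → a * (proj₁ w * moment G r 0 0)) vs + sumPicks (λ w r → b * (proj₂ w * moment G r 0 0)) vs
        ≈⟨ sumPicks-+ _ _ vs ⟨
      sumPicks (λ w r → a * (proj₁ w * moment G r 0 0) + b * (proj₂ w * moment G r 0 0)) vs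
        ≈⟨ sumPicks-cong vs (λ w r → solve 5 (λ a b p q m → a :* (p :* m) :+ b :* (q :* m) := (a :* p :+ b :* q) :* m) refl a b (proj₁ w) (proj₂ w) _) ⟩
      sumPicks (λ w r → ⟪ (a , b) , w ⟫ * moment G r 0 0) vs ∎
      where
      T = ℕ1 F (suc (length vs))
      T≈ : T ≈ ℕ1 F (suc (length vs ℕ.+ 0))
      T≈ = reflexive (≡.cong (λ n → ℕ1 F (suc n)) (≡.sym (ℕP.+-identityʳ (length vs))))
      S₁ = sumPicks (λ w r → proj₁ w * moment G r 0 0) vs
      S₂ = sumPicks (λ w r → proj₂ w * moment G r 0 0) vs

    moment-gram-invariant : ∀ {a} {A : Set a} (L e : A → LinearForm) →
                            (∀ p q → ⟪ L p , L q ⟫ ≈ ⟪ e p , e q ⟫) →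
                            ∀ ps → moment G (map L ps) 0 0 ≈ moment G (map e ps) 0 0
    moment-gram-invariant {A = A} L e gram ps = bounded (length ps) ps ℕP.≤-refl
      where
      bounded : ∀ n (ps : List A) → length ps ℕ.≤ n → moment G (map L ps) 0 0 ≈ moment G (map e ps) 0 0
      bounded n [] _ = refl
      bounded (suc n) (p ∷ ps) (ℕ.s≤s ps≤n) = *-cancelˡ-≉0 (ch (length (map L ps))) (begin
        ℕ1 F (suc (length (map L ps))) * moment G (L p ∷ map L ps) 0 0
          ≈⟨ moment-∷ (L p) (map L ps) ⟩
        sumPicks (λ w r → ⟪ L p , w ⟫ * moment G r 0 0) (map L ps)
          ≈⟨ sumPicks-map L _ ps ⟩
        sumPicks (λ q r → ⟪ L p , L q ⟫ * moment G (map L r) 0 0) ps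
          ≈⟨ sumPicks-cong-shorter ps (λ q r r<ps → *-cong (gram p q) (bounded n r (ℕP.≤-trans (ℕP.<⇒≤ r<ps) ps≤n))) ⟩
        sumPicks (λ q r → ⟪ e p , e q ⟫ * moment G (map e r) 0 0) ps
          ≈⟨ sumPicks-map e _ ps ⟨
        sumPicks (λ w r → ⟪ e p , w ⟫ * moment G r 0 0) (map e ps)
          ≈⟨ moment-∷ (e p) (map e ps) ⟨
        ℕ1 F (suc (length (map e ps))) * moment G (e p ∷ map e ps) 0 0
          ≡⟨ ≡.cong (λ n → ℕ1 F (suc n) * moment G (e p ∷ map e ps) 0 0)
                    (≡.trans (ListP.length-map e ps) (≡.sym (ListP.length-map L ps))) ⟩
        ℕ1 F (suc (length (map L ps))) * moment G (e p ∷ map e ps) 0 0 ∎)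

  moment-++ : ∀ G us ws x y → moment G (us ++ ws) x y ≈ moment (moment G ws) us x y
  moment-++ G [] ws x y = refl
  moment-++ G ((a , b) ∷ us) ws x y = +-cong (*-congˡ (moment-++ G us ws (suc x) y)) (*-congˡ (moment-++ G us ws x (suc y)))

  moment-replicate-unit₁ : ∀ G k vs x y → moment G (replicate k (1# , 0#) ++ vs) x y ≈ moment G vs (x ℕ.+ k) y
  moment-replicate-unit₁ G zero vs x y = reflexive (≡.cong (λ x′ → moment G vs x′ y) (≡.sym (ℕP.+-identityʳ x)))
  moment-replicate-unit₁ G (suc k) vs x y = begin
    1# * moment G (replicate k (1# , 0#) ++ vs) (suc x) y + 0# * moment G (replicate k (1# , 0#) ++ vs) x (suc y)
      ≈⟨ trans (+-cong (*-identityˡ _) (zeroˡ _)) (+-identityʳ _) ⟩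
    moment G (replicate k (1# , 0#) ++ vs) (suc x) y ≈⟨ moment-replicate-unit₁ G k vs (suc x) y ⟩
    moment G vs (suc x ℕ.+ k) y                       ≡⟨ ≡.cong (λ x′ → moment G vs x′ y) (≡.sym (ℕP.+-suc x k)) ⟩
    moment G vs (x ℕ.+ suc k) y                       ∎

  moment-replicate-unit₂ : ∀ G l x y → moment G (replicate l (0# , 1#)) x y ≈ G x (y ℕ.+ l)
  moment-replicate-unit₂ G zero x y = reflexive (≡.cong (G x) (≡.sym (ℕP.+-identityʳ y)))
  moment-replicate-unit₂ G (suc l) x y = begin
    0# * moment G (replicate l (0# , 1#)) (suc x) y + 1# * moment G (replicate l (0# , 1#)) x (suc y)
      ≈⟨ trans (+-cong (zeroˡ _) (*-identityˡ _)) (+-identityˡ _) ⟩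
    moment G (replicate l (0# , 1#)) x (suc y) ≈⟨ moment-replicate-unit₂ G l x (suc y) ⟩
    G x (suc y ℕ.+ l)                          ≡⟨ ≡.cong (G x) (≡.sym (ℕP.+-suc y l)) ⟩
    G x (y ℕ.+ suc l)                          ∎

  moment-units : ∀ G k l → moment G (replicate k (1# , 0#) ++ replicate l (0# , 1#)) 0 0 ≈ G k l
  moment-units G k l = trans (moment-replicate-unit₁ G k _ 0 0) (moment-replicate-unit₂ G l k 0)

  open Poly F

  extendLinearly : (ℕ → ℕ → Carrier) → Pol → Carrier
  extendLinearly G [] = 0#
  extendLinearly G ((a , k , l) ∷ p) = a * G k l + extendLinearly G p

  ψ≈extendLinearly : ∀ ch p → ψ ch p ≈ extendLinearly (ψmon ch) p
  ψ≈extendLinearly ch [] = refl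
  ψ≈extendLinearly ch ((a , k , l) ∷ p) = +-congˡ (ψ≈extendLinearly ch p)

  extendLinearly-cong : ∀ {G G′} p → (∀ k l → G k l ≈ G′ k l) → extendLinearly G p ≈ extendLinearly G′ p
  extendLinearly-cong [] G≈G′ = refl
  extendLinearly-cong ((a , k , l) ∷ p) G≈G′ = +-cong (*-congˡ (G≈G′ k l)) (extendLinearly-cong p G≈G′)

  extendLinearly-++ : ∀ G p q → extendLinearly G (p ++ q) ≈ extendLinearly G p + extendLinearly G q
  extendLinearly-++ G [] q = sym (+-identityˡ _)
  extendLinearly-++ G ((a , k , l) ∷ p) q = trans (+-congˡ (extendLinearly-++ G p q)) (sym (+-assoc _ _ _))

  extendLinearly-scale : ∀ G x p → extendLinearly G (scale x p) ≈ x * extendLinearly G p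
  extendLinearly-scale G x [] = sym (zeroʳ x)
  extendLinearly-scale G x ((b , k , l) ∷ p) =
    trans (+-cong (*-assoc _ _ _) (extendLinearly-scale G x p)) (sym (distribˡ _ _ _))

  shift : ℕ → ℕ → (ℕ → ℕ → Carrier) → ℕ → ℕ → Carrier
  shift x y G k l = G (x ℕ.+ k) (y ℕ.+ l)

  extendLinearly-map-monomial : ∀ G a k l (g : Term → Term) →
    (∀ b k′ l′ → g (b , k′ , l′) ≡ (a * b , k ℕ.+ k′ , l ℕ.+ l′)) →
    ∀ q → extendLinearly G (map g q) ≈ a * extendLinearly (shift k l G) q
  extendLinearly-map-monomial G a k l g g≡ [] = sym (zeroʳ a)
  extendLinearly-map-monomial G a k l g g≡ ((b , k′ , l′) ∷ q) rewrite g≡ b k′ l′ =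
    trans (+-cong (*-assoc _ _ _) (extendLinearly-map-monomial G a k l g g≡ q)) (sym (distribˡ _ _ _))

  extendLinearly-⊗ : ∀ G p q → extendLinearly G (p ⊗ q) ≈ extendLinearly (λ k l → extendLinearly (shift k l G) q) p
  extendLinearly-⊗ G [] q = refl
  extendLinearly-⊗ G ((a , k , l) ∷ p) q =
    trans (extendLinearly-++ G (map _ q) (p ⊗ q))
          (+-cong (extendLinearly-map-monomial G a k l _ (λ _ _ _ → ≡.refl) q) (extendLinearly-⊗ G p q))

  linProd : List LinearForm → Pol
  linProd [] = one
  linProd ((a , b) ∷ vs) = lin a b ⊗ linProd vs

  lin^^≡linProd-replicate : ∀ a b n → lin a b ^^ n ≡ linProd (replicate n (a , b))
  lin^^≡linProd-replicate a b zero = ≡.refl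
  lin^^≡linProd-replicate a b (suc n) = ≡.cong (lin a b ⊗_) (lin^^≡linProd-replicate a b n)

  extendLinearly-linProd : ∀ G vs x y → extendLinearly (shift x y G) (linProd vs) ≈ moment G vs x y
  extendLinearly-linProd G [] x y =
    trans (+-identityʳ _) (trans (*-identityˡ _) (reflexive (≡.cong₂ G (ℕP.+-identityʳ x) (ℕP.+-identityʳ y))))
  extendLinearly-linProd G ((a , b) ∷ vs) x y = begin
    extendLinearly (shift x y G) (lin a b ⊗ linProd vs)
      ≈⟨ extendLinearly-⊗ (shift x y G) (lin a b) (linProd vs) ⟩
    a * extendLinearly (shift 1 0 (shift x y G)) (linProd vs) + (b * extendLinearly (shift 0 1 (shift x y G)) (linProd vs) + 0#)
      ≈⟨ +-cong (*-congˡ (extendLinearly-cong (linProd vs) λ k l → reflexive (≡.cong (λ x′ → G x′ (y ℕ.+ l)) (ℕP.+-suc x k))))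
                (trans (+-identityʳ _) (*-congˡ (extendLinearly-cong (linProd vs) λ k l → reflexive (≡.cong (G (x ℕ.+ k)) (ℕP.+-suc y l))))) ⟩
    a * extendLinearly (shift (suc x) y G) (linProd vs) + b * extendLinearly (shift x (suc y) G) (linProd vs)
      ≈⟨ +-cong (*-congˡ (extendLinearly-linProd G vs (suc x) y)) (*-congˡ (extendLinearly-linProd G vs x (suc y))) ⟩
    a * moment G vs (suc x) y + b * moment G vs x (suc y) ∎

  extendLinearly-linProd-⊗ : ∀ G us ws → extendLinearly G (linProd us ⊗ linProd ws) ≈ moment G (us ++ ws) 0 0
  extendLinearly-linProd-⊗ G us ws = begin
    extendLinearly G (linProd us ⊗ linProd ws)
      ≈⟨ extendLinearly-⊗ G (linProd us) (linProd ws) ⟩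
    extendLinearly (λ k l → extendLinearly (shift k l G) (linProd ws)) (linProd us)
      ≈⟨ extendLinearly-cong (linProd us) (extendLinearly-linProd G ws) ⟩
    extendLinearly (moment G ws) (linProd us) ≈⟨ extendLinearly-linProd (moment G ws) us 0 0 ⟩
    moment (moment G ws) us 0 0               ≈⟨ moment-++ G us ws 0 0 ⟨
    moment G (us ++ ws) 0 0                   ∎

  column : Mat2 → Bool → LinearForm
  column h true = (h₁₁ h , h₂₁ h)
  column h false = (h₁₂ h , h₂₂ h)

  unit : Bool → LinearForm
  unit true = (1# , 0#)
  unit false = (0# , 1#)

  Orthogonal : Mat2 → Set ℓ
  Orthogonal h = ∀ p q → ⟪ column h p , column h q ⟫ ≈ ⟪ unit p , unit q ⟫

  InSO2⇒Orthogonal : ∀ {h} → InSO2 h → Orthogonal h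
  InSO2⇒Orthogonal h∈SO2 true true =
    trans (InSO2.hᵀh₁₁ h∈SO2) (sym (trans (+-cong (*-identityˡ 1#) (zeroˡ 0#)) (+-identityʳ 1#)))
  InSO2⇒Orthogonal h∈SO2 true false =
    trans (InSO2.hᵀh₁₂ h∈SO2) (sym (trans (+-cong (*-identityˡ 0#) (zeroˡ 1#)) (+-identityʳ 0#)))
  InSO2⇒Orthogonal h∈SO2 false true =
    trans (InSO2.hᵀh₂₁ h∈SO2) (sym (trans (+-cong (zeroˡ 1#) (*-identityˡ 0#)) (+-identityˡ 0#)))
  InSO2⇒Orthogonal h∈SO2 false false =
    trans (InSO2.hᵀh₂₂ h∈SO2) (sym (trans (+-cong (zeroˡ 0#) (*-identityˡ 1#)) (+-identityˡ 1#)))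

  bits : ℕ → ℕ → List Bool
  bits k l = replicate k true ++ replicate l false

  map-bits : ∀ {a} {A : Set a} (f : Bool → A) k l → map f (bits k l) ≡ replicate k (f true) ++ replicate l (f false)
  map-bits f k l = ≡.trans (ListP.map-++ f (replicate k true) (replicate l false))
                           (≡.cong₂ _++_ (ListP.map-replicate f k true) (ListP.map-replicate f l false))

  extendLinearly-act-monomial : ∀ G h k l →
    extendLinearly G ((lin (h₁₁ h) (h₂₁ h) ^^ k) ⊗ (lin (h₁₂ h) (h₂₂ h) ^^ l)) ≈ moment G (map (column h) (bits k l)) 0 0
  extendLinearly-act-monomial G h k l
    rewrite lin^^≡linProd-replicate (h₁₁ h) (h₂₁ h) k | lin^^≡linProd-replicate (h₁₂ h) (h₂₂ h) l | map-bits (column h) k l =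
    extendLinearly-linProd-⊗ G (replicate k (column h true)) (replicate l (column h false))

  module _ (ch : CharZero F) {G : ℕ → ℕ → Carrier}
           (G-parts : IntegratesByParts G) (Gᵀ-parts : IntegratesByParts (flip G)) where

    extendLinearly-act : ∀ h → Orthogonal h → ∀ π → extendLinearly G (act h π) ≈ extendLinearly G π
    extendLinearly-act h h-orth [] = refl
    extendLinearly-act h h-orth ((x , k , l) ∷ π) = begin
      extendLinearly G (scale x P ++ act h π)                        ≈⟨ extendLinearly-++ G (scale x P) (act h π) ⟩
      extendLinearly G (scale x P) + extendLinearly G (act h π)      ≈⟨ +-cong (extendLinearly-scale G x P) (extendLinearly-act h h-orth π) ⟩
      x * extendLinearly G P + extendLinearly G π                    ≈⟨ +-congʳ (*-congˡ (extendLinearly-act-monomial G h k l)) ⟩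
      x * moment G (map (column h) (bits k l)) 0 0 + extendLinearly G π
        ≈⟨ +-congʳ (*-congˡ (moment-gram-invariant ch G-parts Gᵀ-parts (column h) unit h-orth (bits k l))) ⟩
      x * moment G (map unit (bits k l)) 0 0 + extendLinearly G π
        ≡⟨ ≡.cong (λ vs → x * moment G vs 0 0 + extendLinearly G π) (map-bits unit k l) ⟩
      x * moment G (replicate k (1# , 0#) ++ replicate l (0# , 1#)) 0 0 + extendLinearly G π
        ≈⟨ +-congʳ (*-congˡ (moment-units G k l)) ⟩
      x * G k l + extendLinearly G π ∎
      where
      P = (lin (h₁₁ h) (h₂₁ h) ^^ k) ⊗ (lin (h₁₂ h) (h₂₂ h) ^^ l)

theorem12 : ∀ {c ℓ} (F : Field c ℓ) (ch : CharZero F) →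
    let open Field F
        open Poly F
    in (h : Mat2) → InSO2 h → (π : Pol) → ψ ch (act h π) ≈ ψ ch π
theorem12 F ch h h∈SO2 π = begin
  ψ ch (act h π)                    ≈⟨ ψ≈extendLinearly F ch (act h π) ⟩
  extendLinearly F (ψmon ch) (act h π)
    ≈⟨ extendLinearly-act F ch (ψmon-integratesByParts F ch) (ψmonᵀ-integratesByParts F ch) h (InSO2⇒Orthogonal F h∈SO2) π ⟩
  extendLinearly F (ψmon ch) π      ≈⟨ ψ≈extendLinearly F ch π ⟨
  ψ ch π                            ∎
  where
  open Field F
  open Poly F
  open import Relation.Binary.Reasoning.Setoid setoid
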